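{- Let $N\ge1$ be an integer. For every integer $M$ with $0\leq M\leq\binom{\lfloor N/2\rfloor+1}{2}-1$ there is a graph $G$ with $e(G)=N$ and $e(L(G))=M$.
   Context: All graphs are finite and simple; $L(G)$ is the line graph of $G$ (vertices are the edges of $G$, adjacent when sharing an endpoint), so $e(L(G))=\sum_v\binom{\deg(v)}{2}$. -}

module Defs where

open import Data.Nat using (ℕ; zero; suc; _+_; _<ᵇ_)
open import Data.Nat.Combinatorics using (_C_)
open import Data.Bool using (Bool; true; false; if_then_else_)
open import Data.Fin using (Fin; toℕ)
open import Data.List using (List; []; _∷_; map; allFin)
open import Data.Nat.ListAction using (sum)
open import Relation.Binary.PropositionalEquality using (_≡_)

record Graph : Set where
  field
    n     : ℕ
    adj   : Fin n → Fin n → Bool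
    sym   : ∀ i j → adj i j ≡ adj j i
    irrefl : ∀ i → adj i i ≡ false

open Graph public

count : {A : Set} → (A → Bool) → List A → ℕ
count p [] = 0
count p (x ∷ xs) = (if p x then 1 else 0) + count p xs

deg : (G : Graph) → Fin (n G) → ℕ
deg G v = count (adj G v) (allFin (n G))

edges : Graph → ℕ
edges G = sum (map (λ i → count (λ j → if toℕ i <ᵇ toℕ j then adj G i j else false)
                                  (allFin (n G)))
                   (allFin (n G)))

-- e(L(G)) = Σ_v C(deg v, 2)   (number of edges of the line graph)
lineEdges : Graph → ℕ
lineEdges G = sum (map (λ v → deg G v C 2) (allFin (n G)))

-- Write M = C(e+1,2) + r with r ≤ e. The broom obtained from the star K_{1,e}
-- by hanging a path of r+1 edges on its centre has e+r+1 edges, and its line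
-- graph has C(e+1,2) + r edges: the centre has degree e+1, the r interior
-- vertices of the path have degree 2, all others degree 1. The bound on M
-- forces e < N/2 (unless e = 0), so e+r+1 ≤ N, and the missing edges are
-- added as isolated edges, which contribute nothing to e(L(G)).
module Submission where

open import Defs
open import Data.Nat using (ℕ; _≤_; _/_; _∸_; suc)
open import Data.Nat.Combinatorics using (_C_)
open import Data.Product using (Σ; _×_)
open import Relation.Binary.PropositionalEquality using (_≡_)

open import Data.Bool using (Bool; true; false; if_then_else_)
open import Data.Fin using (Fin; zero; suc; toℕ; _≟_)
open import Data.List using (List; []; _∷_; map; tabulate; allFin; length)
open import Data.List.Properties using (length-tabulate)
open import Data.Nat using (zero; _+_; _*_; _<_; _<ᵇ_; z≤n; s≤s; _<?_)
open import Data.Nat.Combinatorics using (nCk+nC[k+1]≡[n+1]C[k+1]; nC1≡n)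
open import Data.Nat.DivMod using (m/n*n≤m)
open import Data.Nat.ListAction using (sum)
open import Data.Nat.Properties
  using ( +-0-commutativeMonoid; +-identityʳ; +-comm; +-suc; *-comm; m∸n+n≡m
        ; ≤-refl; ≤-reflexive; ≤-trans; ≤-pred; <⇒≤; <⇒≱; ≮⇒≥; m≤n⇒m<n∨m≡n
        ; m≤m+n; m≤n+m; +-monoʳ-≤; +-mono-≤; module ≤-Reasoning )
open import Algebra.Properties.CommutativeMonoid.Sum +-0-commutativeMonoid
  using (sum-syntax; sum-cong-≗; sum-replicate-zero; ∑-distrib-+)
open import Data.Product using (∃₂; _,_)
open import Data.Sum using (inj₁; inj₂)
open import Function using (id; _∘_)
open import Relation.Nullary using (yes; no; does; contradiction)
open import Relation.Binary.PropositionalEquality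
  using (refl; trans; cong; cong₂; module ≡-Reasoning)
import Relation.Binary.PropositionalEquality as ≡

private
  variable
    A : Set
    k l : ℕ

𝟙 : Bool → ℕ
𝟙 b = if b then 1 else 0

count-tabulate : (p : A → Bool) (f : Fin k → A) →
                 count p (tabulate f) ≡ ∑[ i < k ] 𝟙 (p (f i))
count-tabulate {k = zero}  p f = refl
count-tabulate {k = suc k} p f = cong (𝟙 (p (f zero)) +_) (count-tabulate p (f ∘ suc))

sum-map-tabulate : (g : A → ℕ) (f : Fin k → A) →
                   sum (map g (tabulate f)) ≡ ∑[ i < k ] g (f i)
sum-map-tabulate {k = zero}  g f = refl
sum-map-tabulate {k = suc k} g f = cong (g (f zero) +_) (sum-map-tabulate g (f ∘ suc))

count-false : (xs : List A) → count (λ _ → false) xs ≡ 0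
count-false []       = refl
count-false (x ∷ xs) = count-false xs

count-true : (xs : List A) → count (λ _ → true) xs ≡ length xs
count-true []       = refl
count-true (x ∷ xs) = cong suc (count-true xs)

count-true-allFin : ∀ k → count (λ _ → true) (allFin k) ≡ k
count-true-allFin k = trans (count-true (allFin k)) (length-tabulate {n = k} id)

∑-zero : {f : Fin k → ℕ} → (∀ i → f i ≡ 0) → ∑[ i < k ] f i ≡ 0
∑-zero {k} f≗0 = trans (sum-cong-≗ f≗0) (sum-replicate-zero k)

∑-indicator : (v : Fin k) (f : Fin k → ℕ) →
              ∑[ u < k ] (if does (u ≟ v) then f u else 0) ≡ f v
∑-indicator {suc k} zero f = trans (cong (f zero +_) (∑-zero {k} λ _ → refl)) (+-identityʳ (f zero))
∑-indicator (suc v)      f = ∑-indicator v (f ∘ suc)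

count-≟ : (v : Fin k) → count (λ u → does (u ≟ v)) (allFin k) ≡ 1
count-≟ v = trans (count-tabulate (λ u → does (u ≟ v)) id) (∑-indicator v λ _ → 1)

[1+k]C2≡k+kC2 : ∀ k → suc k C 2 ≡ k + k C 2
[1+k]C2≡k+kC2 k = ≡.sym (trans (cong (_+ k C 2) (≡.sym (nC1≡n k)))
                                 (nCk+nC[k+1]≡[n+1]C[k+1] k 1))

C2-mono-≤ : l ≤ k → l C 2 ≤ k C 2
C2-mono-≤ {k = zero} z≤n = ≤-refl
C2-mono-≤ {l} {suc k} l≤1+k with m≤n⇒m<n∨m≡n l≤1+k
... | inj₂ refl   = ≤-refl
... | inj₁ l<1+k = ≤-trans (C2-mono-≤ (≤-pred l<1+k))
                           (≤-trans (m≤n+m (k C 2) k) (≤-reflexive (≡.sym ([1+k]C2≡k+kC2 k))))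

C2-cancel-< : l C 2 < k C 2 → l < k
C2-cancel-< {l} {k} lt with l <? k
... | yes l<k = l<k
... | no  l≮k = contradiction (C2-mono-≤ (≮⇒≥ l≮k)) (<⇒≱ lt)

triangular-decomposition : ∀ M → ∃₂ λ e r → r ≤ e × M ≡ suc e C 2 + r
triangular-decomposition zero = 0 , 0 , z≤n , refl
triangular-decomposition (suc M) with triangular-decomposition M
... | e , r , r≤e , M≡ with m≤n⇒m<n∨m≡n r≤e
...   | inj₁ r<e  = e , suc r , r<e , trans (cong suc M≡) (≡.sym (+-suc (suc e C 2) r))
...   | inj₂ refl = suc e , 0 , z≤n , (begin
  suc M                       ≡⟨ cong suc M≡ ⟩
  suc (suc e C 2 + e)         ≡⟨ cong suc (+-comm (suc e C 2) e) ⟩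
  suc e + suc e C 2           ≡⟨ [1+k]C2≡k+kC2 (suc e) ⟨
  suc (suc e) C 2             ≡⟨ +-identityʳ _ ⟨
  suc (suc e) C 2 + 0         ∎)
  where open ≡-Reasoning

l≤k∸1⇒l<k : 1 ≤ l → l ≤ k ∸ 1 → l < k
l≤k∸1⇒l<k {k = zero}  (s≤s z≤n) ()
l≤k∸1⇒l<k {k = suc k} _         l≤k = s≤s l≤k

N/2+N/2≤N : ∀ N → N / 2 + N / 2 ≤ N
N/2+N/2≤N N = begin
  N / 2 + N / 2        ≡⟨ cong (N / 2 +_) (+-identityʳ (N / 2)) ⟨
  2 * (N / 2)          ≡⟨ *-comm 2 (N / 2) ⟩
  N / 2 * 2            ≤⟨ m/n*n≤m N 2 ⟩
  N                    ∎
  where open ≤-Reasoning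

deg-∑ : ∀ G v → deg G v ≡ ∑[ u < n G ] 𝟙 (adj G v u)
deg-∑ G v = count-tabulate (adj G v) id

edges-∑ : ∀ G → edges G ≡
  ∑[ i < n G ] ∑[ j < n G ] 𝟙 (if toℕ i <ᵇ toℕ j then adj G i j else false)
edges-∑ G = trans (sum-map-tabulate (λ i → count (above i) (allFin (n G))) id)
                  (sum-cong-≗ λ i → count-tabulate (above i) id)
  where
  above : Fin (n G) → Fin (n G) → Bool
  above i j = if toℕ i <ᵇ toℕ j then adj G i j else false

lineEdges-∑ : ∀ G → lineEdges G ≡ ∑[ v < n G ] (deg G v C 2)
lineEdges-∑ G = sum-map-tabulate (λ v → deg G v C 2) id

addVertex : (G : Graph) → (Fin (n G) → Bool) → Graph
addVertex G S = record { n = suc (n G) ; adj = adj′ ; sym = sym′ ; irrefl = irrefl′ }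
  where
  adj′ : Fin (suc (n G)) → Fin (suc (n G)) → Bool
  adj′ zero    zero    = false
  adj′ zero    (suc j) = S j
  adj′ (suc i) zero    = S i
  adj′ (suc i) (suc j) = adj G i j

  sym′ : ∀ i j → adj′ i j ≡ adj′ j i
  sym′ zero    zero    = refl
  sym′ zero    (suc j) = refl
  sym′ (suc i) zero    = refl
  sym′ (suc i) (suc j) = Graph.sym G i j

  irrefl′ : ∀ i → adj′ i i ≡ false
  irrefl′ zero    = refl
  irrefl′ (suc i) = irrefl G i

module _ (G : Graph) (S : Fin (n G) → Bool) where

  deg-addVertex-new : deg (addVertex G S) zero ≡ count S (allFin (n G))
  deg-addVertex-new = trans (deg-∑ (addVertex G S) zero) (≡.sym (count-tabulate S id))

  deg-addVertex-old : ∀ v → deg (addVertex G S) (suc v) ≡ 𝟙 (S v) + deg G v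
  deg-addVertex-old v = trans (deg-∑ (addVertex G S) (suc v)) (cong (𝟙 (S v) +_) (≡.sym (deg-∑ G v)))

  edges-addVertex : edges (addVertex G S) ≡ count S (allFin (n G)) + edges G
  edges-addVertex = trans (edges-∑ (addVertex G S))
                          (cong₂ _+_ (≡.sym (count-tabulate S id)) (≡.sym (edges-∑ G)))

  lineEdges-addVertex : lineEdges (addVertex G S) ≡
    count S (allFin (n G)) C 2 + (∑[ v < n G ] (if S v then deg G v else 0) + lineEdges G)
  lineEdges-addVertex = begin
    lineEdges (addVertex G S)
      ≡⟨ lineEdges-∑ (addVertex G S) ⟩
    deg (addVertex G S) zero C 2 + ∑[ v < n G ] (deg (addVertex G S) (suc v) C 2)
      ≡⟨ cong₂ (λ a b → a C 2 + b) deg-addVertex-new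
               (sum-cong-≗ λ v → cong (_C 2) (deg-addVertex-old v)) ⟩
    d₀ C 2 + ∑[ v < n G ] ((𝟙 (S v) + deg G v) C 2)
      ≡⟨ cong (d₀ C 2 +_) (sum-cong-≗ λ v → neighbourGain (S v) (deg G v)) ⟩
    d₀ C 2 + ∑[ v < n G ] ((if S v then deg G v else 0) + deg G v C 2)
      ≡⟨ cong (d₀ C 2 +_) (∑-distrib-+ (λ v → if S v then deg G v else 0) (λ v → deg G v C 2)) ⟩
    d₀ C 2 + (σ + ∑[ v < n G ] (deg G v C 2))
      ≡⟨ cong (λ x → d₀ C 2 + (σ + x)) (lineEdges-∑ G) ⟨
    d₀ C 2 + (σ + lineEdges G)
      ∎
    where
    open ≡-Reasoning
    d₀ = count S (allFin (n G))
    σ  = ∑[ v < n G ] (if S v then deg G v else 0)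
    neighbourGain : ∀ b d → (𝟙 b + d) C 2 ≡ (if b then d else 0) + d C 2
    neighbourGain true  d = [1+k]C2≡k+kC2 d
    neighbourGain false d = refl

addIsolatedVertex : Graph → Graph
addIsolatedVertex G = addVertex G (λ _ → false)

module _ (G : Graph) where

  deg-addIsolatedVertex-new : deg (addIsolatedVertex G) zero ≡ 0
  deg-addIsolatedVertex-new = trans (deg-addVertex-new G _) (count-false (allFin (n G)))

  edges-addIsolatedVertex : edges (addIsolatedVertex G) ≡ edges G
  edges-addIsolatedVertex =
    trans (edges-addVertex G _) (cong (_+ edges G) (count-false (allFin (n G))))

  lineEdges-addIsolatedVertex : lineEdges (addIsolatedVertex G) ≡ lineEdges G
  lineEdges-addIsolatedVertex =
    trans (lineEdges-addVertex G _)
          (cong₂ (λ d σ → d C 2 + (σ + lineEdges G)) (count-false (allFin (n G)))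
                 (∑-zero {n G} λ _ → refl))

addLeaf : (G : Graph) → Fin (n G) → Graph
addLeaf G v = addVertex G (λ u → does (u ≟ v))

module _ (G : Graph) (v : Fin (n G)) where

  deg-addLeaf-new : deg (addLeaf G v) zero ≡ 1
  deg-addLeaf-new = trans (deg-addVertex-new G _) (count-≟ v)

  edges-addLeaf : edges (addLeaf G v) ≡ suc (edges G)
  edges-addLeaf = trans (edges-addVertex G _) (cong (_+ edges G) (count-≟ v))

  lineEdges-addLeaf : lineEdges (addLeaf G v) ≡ deg G v + lineEdges G
  lineEdges-addLeaf =
    trans (lineEdges-addVertex G _)
          (cong₂ (λ d σ → d C 2 + (σ + lineEdges G)) (count-≟ v) (∑-indicator v (deg G)))

attachPath : ℕ → (G : Graph) → Fin (n G) → Graph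
attachPath zero    G v = G
attachPath (suc p) G v = attachPath p (addLeaf G v) zero

edges-attachPath : ∀ p G v → edges (attachPath p G v) ≡ p + edges G
edges-attachPath zero    G v = refl
edges-attachPath (suc p) G v =
  trans (edges-attachPath p (addLeaf G v) zero)
        (trans (cong (p +_) (edges-addLeaf G v)) (+-suc p (edges G)))

lineEdges-attachPath : ∀ p G v →
  lineEdges (attachPath (suc p) G v) ≡ p + (deg G v + lineEdges G)
lineEdges-attachPath zero    G v = lineEdges-addLeaf G v
lineEdges-attachPath (suc p) G v =
  trans (lineEdges-attachPath p (addLeaf G v) zero)
        (trans (cong (p +_) (cong₂ _+_ (deg-addLeaf-new G v) (lineEdges-addLeaf G v)))
               (+-suc p (deg G v + lineEdges G)))

addIsolatedEdges : ℕ → Graph → Graph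
addIsolatedEdges zero    G = G
addIsolatedEdges (suc m) G = addLeaf (addIsolatedVertex (addIsolatedEdges m G)) zero

edges-addIsolatedEdges : ∀ m G → edges (addIsolatedEdges m G) ≡ m + edges G
edges-addIsolatedEdges zero    G = refl
edges-addIsolatedEdges (suc m) G =
  trans (edges-addLeaf (addIsolatedVertex H) zero)
        (cong suc (trans (edges-addIsolatedVertex H) (edges-addIsolatedEdges m G)))
  where H = addIsolatedEdges m G

lineEdges-addIsolatedEdges : ∀ m G → lineEdges (addIsolatedEdges m G) ≡ lineEdges G
lineEdges-addIsolatedEdges zero    G = refl
lineEdges-addIsolatedEdges (suc m) G =
  trans (lineEdges-addLeaf (addIsolatedVertex H) zero)
        (cong₂ _+_ (deg-addIsolatedVertex-new H)
                   (trans (lineEdges-addIsolatedVertex H) (lineEdges-addIsolatedEdges m G)))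
  where H = addIsolatedEdges m G

edgeless : ℕ → Graph
edgeless k = record { n = k ; adj = λ _ _ → false ; sym = λ _ _ → refl ; irrefl = λ _ → refl }

deg-edgeless : ∀ k v → deg (edgeless k) v ≡ 0
deg-edgeless k v = count-false (allFin k)

edges-edgeless : ∀ k → edges (edgeless k) ≡ 0
edges-edgeless k = trans (edges-∑ (edgeless k)) (∑-zero {k} λ i → ∑-zero {k} λ j → noEdge (toℕ i <ᵇ toℕ j))
  where
  noEdge : ∀ b → 𝟙 (if b then false else false) ≡ 0
  noEdge true  = refl
  noEdge false = refl

lineEdges-edgeless : ∀ k → lineEdges (edgeless k) ≡ 0
lineEdges-edgeless k = trans (lineEdges-∑ (edgeless k)) (∑-zero {k} λ v → cong (_C 2) (deg-edgeless k v))

star : ℕ → Graph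
star e = addVertex (edgeless e) (λ _ → true)

deg-star-centre : ∀ e → deg (star e) zero ≡ e
deg-star-centre e = trans (deg-addVertex-new (edgeless e) _)
                          (count-true-allFin e)

edges-star : ∀ e → edges (star e) ≡ e
edges-star e = trans (edges-addVertex (edgeless e) _)
  (trans (cong₂ _+_ (count-true-allFin e) (edges-edgeless e))
         (+-identityʳ e))

lineEdges-star : ∀ e → lineEdges (star e) ≡ e C 2
lineEdges-star e = trans (lineEdges-addVertex (edgeless e) _)
  (trans (cong₂ (λ d σ → d C 2 + σ) (count-true-allFin e)
                (cong₂ _+_ (∑-zero {e} (deg-edgeless e)) (lineEdges-edgeless e)))
         (+-identityʳ (e C 2)))

broom : ℕ → ℕ → Graph
broom e r = attachPath (suc r) (star e) zero

edges-broom : ∀ e r → edges (broom e r) ≡ e + suc r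
edges-broom e r = trans (edges-attachPath (suc r) (star e) zero)
                        (trans (cong (suc r +_) (edges-star e)) (+-comm (suc r) e))

lineEdges-broom : ∀ e r → lineEdges (broom e r) ≡ suc e C 2 + r
lineEdges-broom e r = begin
  lineEdges (broom e r)                         ≡⟨ lineEdges-attachPath r (star e) zero ⟩
  r + (deg (star e) zero + lineEdges (star e))  ≡⟨ cong (r +_) (cong₂ _+_ (deg-star-centre e) (lineEdges-star e)) ⟩
  r + (e + e C 2)                               ≡⟨ cong (r +_) ([1+k]C2≡k+kC2 e) ⟨
  r + suc e C 2                                 ≡⟨ +-comm r (suc e C 2) ⟩
  suc e C 2 + r                                 ∎
  where open ≡-Reasoning

broom-fits : ∀ {N e r} → 1 ≤ N → r ≤ e → suc e C 2 + r ≤ suc (N / 2) C 2 ∸ 1 → e + suc r ≤ N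
broom-fits {e = zero} 1≤N z≤n _ = 1≤N
broom-fits {N} {suc e} {r} _ r≤1+e bound = begin
  suc e + suc r        ≤⟨ +-monoʳ-≤ (suc e) (s≤s r≤1+e) ⟩
  suc e + suc (suc e)  ≤⟨ +-mono-≤ (<⇒≤ 1+e<k) 1+e<k ⟩
  N / 2 + N / 2        ≤⟨ N/2+N/2≤N N ⟩
  N                    ∎
  where
  open ≤-Reasoning
  1+e<k : suc e < N / 2
  1+e<k = ≤-pred (C2-cancel-< (l≤k∸1⇒l<k (C2-mono-≤ {2} {suc (suc e)} (s≤s (s≤s z≤n)))
                                        (≤-trans (m≤m+n (suc (suc e) C 2) r) bound)))

mainTheorem17 : (N : ℕ) → 1 ≤ N → (M : ℕ) → M ≤ (suc (N / 2) C 2) ∸ 1 →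
    Σ Graph (λ G → edges G ≡ N × lineEdges G ≡ M)
mainTheorem17 N 1≤N M M≤ with triangular-decomposition M
... | e , r , r≤e , M≡ = G , edges-G , lineEdges-G
  where
  fits : e + suc r ≤ N
  fits = broom-fits 1≤N r≤e (≡.subst (_≤ suc (N / 2) C 2 ∸ 1) M≡ M≤)

  G : Graph
  G = addIsolatedEdges (N ∸ (e + suc r)) (broom e r)

  edges-G : edges G ≡ N
  edges-G = trans (edges-addIsolatedEdges (N ∸ (e + suc r)) (broom e r))
                  (trans (cong (N ∸ (e + suc r) +_) (edges-broom e r)) (m∸n+n≡m fits))

  lineEdges-G : lineEdges G ≡ M
  lineEdges-G = trans (lineEdges-addIsolatedEdges (N ∸ (e + suc r)) (broom e r))
                      (trans (lineEdges-broom e r) (≡.sym M≡))
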